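{- Let $\mathcal{G}=(X,\mathcal{F},P)$ be a Maker-Breaker poset positional game where $P$ is made of pairwise disjoint chains, with Maker starting. If $|X|$ is odd and $\{u\},\{v\}\in\mathcal{F}$ for some black vertices $u$ and $v$ lying on different chains, then Maker has a winning strategy.
   Context: A poset positional game is a triple $(X,\mathcal{F},P)$ with $X$ a finite board of vertices, $\mathcal{F}\subseteq 2^X$ the winning sets, and $P$ a partial order on $X$. Two players alternately claim an unclaimed vertex $v$ such that all vertices smaller than $v$ in $P$ are already claimed, until all vertices are claimed. In the Maker-Breaker convention, Maker wins if she claims all vertices of some winning set; otherwise Breaker wins. $P$ is made of pairwise disjoint chains $C_1,\dots,C_w$ (partitioning $X$, elements of distinct chains incomparable); the elements of $C_i$ are written $x_{i,1}>x_{i,2}>\dots>x_{i,\ell_i}$ (numbered from top to bottom). The vertex $x_{i,j}$ is colored white if $j$ has the same parity as $|X|$, and black otherwise. -}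

module Defs where

open import Data.Nat using (ℕ; suc; _%_; _<_)
open import Data.Fin using (Fin; toℕ)
open import Data.List using (List; []; _∷_; map; allFin)
open import Data.Nat.ListAction using (sum)
open import Data.List.Membership.Propositional using (_∈_)
open import Data.List.Relation.Unary.All using (All)
open import Data.List.Relation.Unary.Any using (Any)
open import Data.Product using (Σ; _×_; _,_; proj₁; ∃-syntax)
open import Data.Sum using (_⊎_)
open import Relation.Nullary using (¬_)
open import Relation.Binary.PropositionalEquality using (_≡_; _≢_)

-- A poset made of w pairwise disjoint chains C_0,…,C_{w-1}; chain i has
-- length ℓ i.  The vertex (i , j) with j : Fin (ℓ i) is x_{i, toℕ j + 1}
-- (numbered from top to bottom, so larger index = smaller in P).
Vertex : {w : ℕ} → (Fin w → ℕ) → Set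
Vertex {w} ℓ = Σ (Fin w) (λ i → Fin (ℓ i))

boardSize : {w : ℕ} → (Fin w → ℕ) → ℕ
boardSize {w} ℓ = sum (map ℓ (allFin w))

Black : {w : ℕ} (ℓ : Fin w → ℕ) → Vertex ℓ → Set
Black ℓ (i , j) = suc (toℕ j) % 2 ≢ boardSize ℓ % 2

record Position {w : ℕ} (ℓ : Fin w → ℕ) : Set where
  constructor pos
  field
    makerSet   : List (Vertex ℓ)
    breakerSet : List (Vertex ℓ)
open Position public

Claimed : {w : ℕ} {ℓ : Fin w → ℕ} → Position ℓ → Vertex ℓ → Set
Claimed p v = v ∈ makerSet p ⊎ v ∈ breakerSet p

Complete : {w : ℕ} {ℓ : Fin w → ℕ} → Position ℓ → Set
Complete {ℓ = ℓ} p = (v : Vertex ℓ) → Claimed p v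

Legal : {w : ℕ} {ℓ : Fin w → ℕ} → Position ℓ → Vertex ℓ → Set
Legal {ℓ = ℓ} p (i , j) =
  ¬ Claimed p (i , j) ×
  ((k : Fin (ℓ i)) → toℕ j < toℕ k → Claimed p (i , k))

-- Maker owns all vertices of some winning set (winning sets are given as
-- lists, read as the sets of their entries).
MakerOwnsWinningSet : {w : ℕ} {ℓ : Fin w → ℕ} →
  List (List (Vertex ℓ)) → Position ℓ → Set
MakerOwnsWinningSet F p = Any (λ A → All (_∈ makerSet p) A) F

data Player : Set where
  maker breaker : Player

data MakerWins {w : ℕ} (ℓ : Fin w → ℕ) (F : List (List (Vertex ℓ))) :
       Player → Position ℓ → Set where
  finished : ∀ {t p} → Complete p → MakerOwnsWinningSet F p →
             MakerWins ℓ F t p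
  makerMove : ∀ {p} → ¬ Complete p → (v : Vertex ℓ) → Legal p v →
              MakerWins ℓ F breaker (pos (v ∷ makerSet p) (breakerSet p)) →
              MakerWins ℓ F maker p
  breakerMove : ∀ {p} → ¬ Complete p →
              ((v : Vertex ℓ) → Legal p v →
                 MakerWins ℓ F maker (pos (makerSet p) (v ∷ breakerSet p))) →
              MakerWins ℓ F breaker p

SingletonIn : {w : ℕ} {ℓ : Fin w → ℕ} →
  List (List (Vertex ℓ)) → Vertex ℓ → Set
SingletonIn {ℓ = ℓ} F u =
  ∃[ A ] (A ∈ F × ((x : Vertex ℓ) → (x ∈ A → x ≡ u) × (x ≡ u → x ∈ A)))

-- Let u = x_{i,a+1} and v = x_{i',b+1}.  Maker keeps two reserves which she never enters herself:
-- the top a + 2 vertices of chain i (down to the vertex just below u) and the top b + 2 vertices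
-- of chain i'.  Since u and v are black and |X| is odd, a and b are odd, so the reserves have odd
-- sizes and the number of vertices outside them (the slack) is odd.  Maker always claims a slack
-- vertex; by parity there is one left on each of her turns.  Hence Breaker is eventually forced
-- into a reserve, where his only move is the vertex just below u (or v), which frees u (or v) for
-- Maker.  If u or v is the bottom of its chain, Maker simply claims it at once.
module Submission where

open import Data.Empty using (⊥-elim)
open import Data.Fin using (Fin; toℕ; fromℕ<) renaming (zero to fzero; suc to fsuc)
open import Data.Fin.Properties using (_≟_; toℕ<n; toℕ-fromℕ<; toℕ-injective)
open import Data.List using (List; []; _∷_; tabulate)
open import Data.List.Membership.Propositional using (_∈_; lose)
open import Data.List.Properties using (map-tabulate)
import Data.List.Relation.Unary.All as All
open import Data.List.Relation.Unary.Any using (here; there)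
import Data.List.Relation.Unary.Any as Any
open import Data.Nat using (ℕ; zero; suc; _+_; _∸_; _%_; _≤_; _<_; z≤n; s≤s)
import Data.Nat.ListAction as List
open import Data.Nat.Properties
  using (+-0-commutativeMonoid; +-assoc; +-comm; +-∸-comm; m+[n∸m]≡n; m∸[m∸n]≡n; n∸n≡0; m∸n≤m;
         m+n≡0⇒m≡0; m+n≡0⇒n≡0; suc-injective; 0≢1+n; ≤-refl; ≤-trans; ≤-reflexive; ≤-antisym;
         <-≤-trans; <⇒≱; ≰⇒>; ≮⇒≥; 1+n≰n; ≤∧≢⇒<; m≤n⇒m<n∨m≡n)
open import Data.Product using (_×_; _,_; proj₁; proj₂; ∃-syntax; Σ-syntax)
open import Data.Sum using (_⊎_; inj₁; inj₂)
open import Data.Vec.Functional using (updateAt)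
open import Data.Vec.Functional.Properties using (updateAt-updates; updateAt-minimal)
open import Function using (_∘_; id)
open import Relation.Binary.PropositionalEquality
  using (_≡_; _≢_; refl; sym; trans; cong; subst; module ≡-Reasoning)
open import Relation.Nullary using (¬_; yes; no)

open import Algebra.Properties.CommutativeMonoid.Sum +-0-commutativeMonoid using (sum)

open import Defs

open ≡-Reasoning

n%2≢1⇒n%2≡0 : ∀ n → n % 2 ≢ 1 → n % 2 ≡ 0
n%2≢1⇒n%2≡0 zero          _     = refl
n%2≢1⇒n%2≡0 (suc zero)    n%2≢1 = ⊥-elim (n%2≢1 refl)
n%2≢1⇒n%2≡0 (suc (suc n)) n%2≢1 = n%2≢1⇒n%2≡0 n n%2≢1

[1+n]%2≡1⇒n%2≡0 : ∀ n → suc n % 2 ≡ 1 → n % 2 ≡ 0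
[1+n]%2≡1⇒n%2≡0 zero          _  = refl
[1+n]%2≡1⇒n%2≡0 (suc zero)    ()
[1+n]%2≡1⇒n%2≡0 (suc (suc n)) eq = [1+n]%2≡1⇒n%2≡0 n eq

[1+n]%2≡0⇒n%2≡1 : ∀ n → suc n % 2 ≡ 0 → n % 2 ≡ 1
[1+n]%2≡0⇒n%2≡1 zero          ()
[1+n]%2≡0⇒n%2≡1 (suc zero)    _  = refl
[1+n]%2≡0⇒n%2≡1 (suc (suc n)) eq = [1+n]%2≡0⇒n%2≡1 n eq

m%2≡0⇒[m+n]%2≡n%2 : ∀ m n → m % 2 ≡ 0 → (m + n) % 2 ≡ n % 2
m%2≡0⇒[m+n]%2≡n%2 zero          n _  = refl
m%2≡0⇒[m+n]%2≡n%2 (suc zero)    n ()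
m%2≡0⇒[m+n]%2≡n%2 (suc (suc m)) n eq = m%2≡0⇒[m+n]%2≡n%2 m n eq

m%2≡1⇒n%2≡1⇒[m+n]%2≡0 : ∀ m n → m % 2 ≡ 1 → n % 2 ≡ 1 → (m + n) % 2 ≡ 0
m%2≡1⇒n%2≡1⇒[m+n]%2≡0 zero          n ()
m%2≡1⇒n%2≡1⇒[m+n]%2≡0 (suc zero)    zero          _ ()
m%2≡1⇒n%2≡1⇒[m+n]%2≡0 (suc zero)    (suc zero)    _ _  = refl
m%2≡1⇒n%2≡1⇒[m+n]%2≡0 (suc zero)    (suc (suc n)) eq eq' = m%2≡1⇒n%2≡1⇒[m+n]%2≡0 1 n eq eq'
m%2≡1⇒n%2≡1⇒[m+n]%2≡0 (suc (suc m)) n eq eq' = m%2≡1⇒n%2≡1⇒[m+n]%2≡0 m n eq eq'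

sum-tabulate : ∀ {n} (f : Fin n → ℕ) → List.sum (tabulate f) ≡ sum f
sum-tabulate {zero}  f = refl
sum-tabulate {suc n} f = cong (f fzero +_) (sum-tabulate (f ∘ fsuc))

boardSize≡sum : ∀ {w} (ℓ : Fin w → ℕ) → boardSize ℓ ≡ sum ℓ
boardSize≡sum {w} ℓ = trans (cong List.sum (map-tabulate (λ i → i) ℓ)) (sum-tabulate ℓ)

sum-updateAt-∸ : ∀ {n} (f : Fin n → ℕ) k {c} → c ≤ f k → sum f ≡ c + sum (updateAt f k (_∸ c))
sum-updateAt-∸ f fzero {c} c≤fk = begin
  f fzero + S                 ≡⟨ cong (_+ S) (sym (m+[n∸m]≡n c≤fk)) ⟩
  c + (f fzero ∸ c) + S       ≡⟨ +-assoc c _ S ⟩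
  c + ((f fzero ∸ c) + S)     ∎
  where S = sum (f ∘ fsuc)
sum-updateAt-∸ f (fsuc k) {c} c≤fk = begin
  f fzero + sum (f ∘ fsuc)    ≡⟨ cong (f fzero +_) (sum-updateAt-∸ (f ∘ fsuc) k c≤fk) ⟩
  f fzero + (c + U)           ≡⟨ sym (+-assoc (f fzero) c U) ⟩
  f fzero + c + U             ≡⟨ cong (_+ U) (+-comm (f fzero) c) ⟩
  c + f fzero + U             ≡⟨ +-assoc c (f fzero) U ⟩
  c + (f fzero + U)           ∎
  where U = sum (updateAt (f ∘ fsuc) k (_∸ c))

sum≡0⇒≡0 : ∀ {n} (f : Fin n → ℕ) → sum f ≡ 0 → ∀ k → f k ≡ 0
sum≡0⇒≡0 f eq fzero    = m+n≡0⇒m≡0 (f fzero) eq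
sum≡0⇒≡0 f eq (fsuc k) = sum≡0⇒≡0 (f ∘ fsuc) (m+n≡0⇒n≡0 (f fzero) eq) k

sum≡suc⇒∃suc : ∀ {n} (f : Fin n → ℕ) {m} → sum f ≡ suc m → ∃[ k ] ∃[ e ] f k ≡ suc e
sum≡suc⇒∃suc {zero} f ()
sum≡suc⇒∃suc {suc n} f eq with f fzero in f0≡
... | suc e = fzero , e , f0≡
... | zero  with sum≡suc⇒∃suc (f ∘ fsuc) eq
...   | k , e , fk≡ = fsuc k , e , fk≡

sum-updateAt-∸1 : ∀ {n} (f : Fin n → ℕ) k {e m} → f k ≡ suc e → sum f ≡ suc m →
                  sum (updateAt f k (_∸ 1)) ≡ m
sum-updateAt-∸1 f k fk≡ sum≡ =
  suc-injective (trans (sym (sum-updateAt-∸ f k (subst (1 ≤_) (sym fk≡) (s≤s z≤n)))) sum≡)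

updateAt-∸-≤ : ∀ {n} (f : Fin n → ℕ) k c k' → updateAt f k (_∸ c) k' ≤ f k'
updateAt-∸-≤ f k c k' with k' ≟ k
... | yes refl = subst (_≤ f k) (sym (updateAt-updates k f)) (m∸n≤m (f k) c)
... | no k'≢k  = ≤-reflexive (updateAt-minimal k' k f k'≢k)

updateAt-∸1-+ : ∀ {n} {f g h : Fin n → ℕ} {k e} → (∀ k' → f k' ≡ g k' + h k') → g k ≡ suc e →
                ∀ k' → updateAt f k (_∸ 1) k' ≡ updateAt g k (_∸ 1) k' + h k'
updateAt-∸1-+ {f = f} {g} {h} {k} f≡ gk≡ k' with k' ≟ k
... | yes refl = begin
  updateAt f k (_∸ 1) k      ≡⟨ updateAt-updates k f ⟩
  f k ∸ 1                    ≡⟨ cong (_∸ 1) (f≡ k) ⟩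
  (g k + h k) ∸ 1            ≡⟨ +-∸-comm (h k) (subst (1 ≤_) (sym gk≡) (s≤s z≤n)) ⟩
  (g k ∸ 1) + h k            ≡⟨ cong (_+ h k) (sym (updateAt-updates k g)) ⟩
  updateAt g k (_∸ 1) k + h k ∎
... | no k'≢k = begin
  updateAt f k (_∸ 1) k'      ≡⟨ updateAt-minimal k' k f k'≢k ⟩
  f k'                        ≡⟨ f≡ k' ⟩
  g k' + h k'                 ≡⟨ cong (_+ h k') (sym (updateAt-minimal k' k g k'≢k)) ⟩
  updateAt g k (_∸ 1) k' + h k' ∎

module Game {w : ℕ} (ℓ : Fin w → ℕ) (F : List (List (Vertex ℓ))) where

  claimBy : Player → Position ℓ → Vertex ℓ → Position ℓ
  claimBy maker   p v = pos (v ∷ makerSet p) (breakerSet p)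
  claimBy breaker p v = pos (makerSet p) (v ∷ breakerSet p)

  claimed-new : ∀ t p v → Claimed (claimBy t p v) v
  claimed-new maker   p v = inj₁ (here refl)
  claimed-new breaker p v = inj₂ (here refl)

  claimed-old : ∀ t {p v y} → Claimed p y → Claimed (claimBy t p v) y
  claimed-old maker   (inj₁ y∈) = inj₁ (there y∈)
  claimed-old maker   (inj₂ y∈) = inj₂ y∈
  claimed-old breaker (inj₁ y∈) = inj₁ y∈
  claimed-old breaker (inj₂ y∈) = inj₂ (there y∈)

  claimed-claimBy⁻ : ∀ t {p v y} → Claimed (claimBy t p v) y → y ≡ v ⊎ Claimed p y
  claimed-claimBy⁻ maker   (inj₁ (here y≡v))  = inj₁ y≡v
  claimed-claimBy⁻ maker   (inj₁ (there y∈)) = inj₂ (inj₁ y∈)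
  claimed-claimBy⁻ maker   (inj₂ y∈)         = inj₂ (inj₂ y∈)
  claimed-claimBy⁻ breaker (inj₁ y∈)         = inj₂ (inj₁ y∈)
  claimed-claimBy⁻ breaker (inj₂ (here y≡v))  = inj₁ y≡v
  claimed-claimBy⁻ breaker (inj₂ (there y∈)) = inj₂ (inj₂ y∈)

  makerSet-claimBy : ∀ t {p v x} → x ∈ makerSet p → x ∈ makerSet (claimBy t p v)
  makerSet-claimBy maker   = there
  makerSet-claimBy breaker = id

  record Remaining (p : Position ℓ) (d : Fin w → ℕ) : Set where
    field
      remaining≤length : ∀ k → d k ≤ ℓ k
      claimed⇒remaining≤ : ∀ {k} (j : Fin (ℓ k)) → Claimed p (k , j) → d k ≤ toℕ j
      remaining≤⇒claimed : ∀ {k} (j : Fin (ℓ k)) → d k ≤ toℕ j → Claimed p (k , j)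
  open Remaining

  remaining-initial : Remaining (pos [] []) ℓ
  remaining-initial = record
    { remaining≤length   = λ k → ≤-refl
    ; claimed⇒remaining≤ = λ { j (inj₁ ()) ; j (inj₂ ()) }
    ; remaining≤⇒claimed = λ j ℓ≤j → ⊥-elim (<⇒≱ (toℕ<n j) ℓ≤j)
    }

  remaining-legal : ∀ {p d k} {j : Fin (ℓ k)} → Remaining p d → Legal p (k , j) → d k ≡ suc (toℕ j)
  remaining-legal {d = d} {k} {j} rem (unclaimed , below) =
    ≤-antisym d≤1+j (≰⇒> (unclaimed ∘ remaining≤⇒claimed rem j))
    where
      d≤1+j : d k ≤ suc (toℕ j)
      d≤1+j = ≮⇒≥ λ 1+j<d →
        let m = fromℕ< (<-≤-trans 1+j<d (remaining≤length rem k))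
            m≡1+j = toℕ-fromℕ< (<-≤-trans 1+j<d (remaining≤length rem k))
        in <⇒≱ 1+j<d (subst (d k ≤_) m≡1+j (claimed⇒remaining≤ rem m (below m (≤-reflexive (sym m≡1+j)))))

  legal-remaining : ∀ {p d k} {j : Fin (ℓ k)} → Remaining p d → d k ≡ suc (toℕ j) → Legal p (k , j)
  legal-remaining {j = j} rem dk≡ =
    (λ claimed → 1+n≰n (subst (_≤ toℕ j) dk≡ (claimed⇒remaining≤ rem j claimed))) ,
    (λ m j<m → remaining≤⇒claimed rem m (subst (_≤ toℕ m) (sym dk≡) j<m))

  nextVertex : ∀ {p d k e} → Remaining p d → d k ≡ suc e → Σ[ j ∈ Fin (ℓ k) ] d k ≡ suc (toℕ j)
  nextVertex {k = k} rem dk≡ =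
    fromℕ< e<ℓ , trans dk≡ (cong suc (sym (toℕ-fromℕ< e<ℓ)))
    where e<ℓ = ≤-trans (≤-reflexive (sym dk≡)) (remaining≤length rem k)

  legal⇒incomplete : ∀ {p : Position ℓ} {v : Vertex ℓ} → Legal p v → ¬ Complete p
  legal⇒incomplete (unclaimed , _) complete = unclaimed (complete _)

  remaining-incomplete : ∀ {p d k} → Remaining p d → d k ≢ 0 → ¬ Complete p
  remaining-incomplete {d = d} {k} rem dk≢0 with d k in dk≡
  ... | zero  = ⊥-elim (dk≢0 refl)
  ... | suc e = legal⇒incomplete (legal-remaining rem (proj₂ (nextVertex rem dk≡)))

  remaining-complete : ∀ {p d} → Remaining p d → (∀ k → d k ≡ 0) → Complete p
  remaining-complete rem d≡0 (k , j) = remaining≤⇒claimed rem j (subst (_≤ toℕ j) (sym (d≡0 k)) z≤n)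

  remaining-claimBy : ∀ t {p d k} {j : Fin (ℓ k)} → Remaining p d → d k ≡ suc (toℕ j) →
                      Remaining (claimBy t p (k , j)) (updateAt d k (_∸ 1))
  remaining-claimBy t {p} {d} {k} {j} rem dk≡ = record
    { remaining≤length   = λ k' → ≤-trans (updateAt-∸-≤ d k 1 k') (remaining≤length rem k')
    ; claimed⇒remaining≤ = claimed⇒
    ; remaining≤⇒claimed = ⇒claimed
    }
    where
      d'k≡j : updateAt d k (_∸ 1) k ≡ toℕ j
      d'k≡j = trans (updateAt-updates k d) (cong (_∸ 1) dk≡)

      claimed⇒ : ∀ {k'} (j' : Fin (ℓ k')) → Claimed (claimBy t p (k , j)) (k' , j') →
                 updateAt d k (_∸ 1) k' ≤ toℕ j'
      claimed⇒ {k'} j' c with claimed-claimBy⁻ t c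
      ... | inj₁ refl = ≤-reflexive d'k≡j
      ... | inj₂ c'   = ≤-trans (updateAt-∸-≤ d k 1 k') (claimed⇒remaining≤ rem j' c')

      ⇒claimed : ∀ {k'} (j' : Fin (ℓ k')) → updateAt d k (_∸ 1) k' ≤ toℕ j' →
                 Claimed (claimBy t p (k , j)) (k' , j')
      ⇒claimed {k'} j' d'≤j' with k' ≟ k
      ... | no k'≢k =
        claimed-old t (remaining≤⇒claimed rem j' (subst (_≤ toℕ j') (updateAt-minimal k' k d k'≢k) d'≤j'))
      ... | yes refl with j' ≟ j
      ...   | yes refl = claimed-new t p (k , j)
      ...   | no j'≢j  = claimed-old t (remaining≤⇒claimed rem j' (subst (_≤ toℕ j') (sym dk≡) j<j'))
        where
          j<j' : toℕ j < toℕ j'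
          j<j' = ≤∧≢⇒< (subst (_≤ toℕ j') d'k≡j d'≤j') (j'≢j ∘ sym ∘ toℕ-injective)

  singleton-owned : ∀ {p x} → SingletonIn F x → x ∈ makerSet p → MakerOwnsWinningSet F p
  singleton-owned {p} (A , A∈F , A≡[x]) x∈ =
    lose A∈F (All.tabulate λ {y} y∈A → subst (_∈ makerSet p) (sym (proj₁ (A≡[x] y) y∈A)) x∈)

  owned-claimBy : ∀ t p v → MakerOwnsWinningSet F p → MakerOwnsWinningSet F (claimBy t p v)
  owned-claimBy t p v = Any.map (All.map (makerSet-claimBy t))

  makerClaims : ∀ {p d k} {j : Fin (ℓ k)} → Remaining p d → d k ≡ suc (toℕ j) →
                MakerWins ℓ F breaker (claimBy maker p (k , j)) → MakerWins ℓ F maker p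
  makerClaims rem dk≡ = makerMove (legal⇒incomplete legal) _ legal
    where legal = legal-remaining rem dk≡

  makerWins-owned : ∀ n t {p d} → Remaining p d → sum d ≡ n → MakerOwnsWinningSet F p → MakerWins ℓ F t p
  makerWins-owned zero t rem sum≡0 owned =
    finished (remaining-complete rem (sum≡0⇒≡0 _ sum≡0)) owned
  makerWins-owned (suc n) maker {p} {d} rem sum≡ owned =
    let (k , _ , dk≡) = sum≡suc⇒∃suc d sum≡
        (j , dk≡1+j) = nextVertex rem dk≡
    in makerClaims rem dk≡1+j
         (makerWins-owned n breaker (remaining-claimBy maker rem dk≡1+j)
           (sum-updateAt-∸1 d k dk≡1+j sum≡) (owned-claimBy maker p (k , j) owned))
  makerWins-owned (suc n) breaker {p} {d} rem sum≡ owned =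
    let (k , _ , dk≡) = sum≡suc⇒∃suc d sum≡
    in breakerMove (remaining-incomplete {k = k} rem (λ dk≡0 → 0≢1+n (trans (sym dk≡0) dk≡)))
         λ { (k' , j') legal →
           let dk'≡ = remaining-legal rem legal
           in makerWins-owned n maker (remaining-claimBy breaker rem dk'≡)
                (sum-updateAt-∸1 d k' dk'≡ sum≡) (owned-claimBy breaker p (k' , j') owned) }

  makerTakesSingleton : ∀ {p d k} {j : Fin (ℓ k)} → Remaining p d → d k ≡ suc (toℕ j) →
                        SingletonIn F (k , j) → MakerWins ℓ F maker p
  makerTakesSingleton {p} {d} {k} {j} rem dk≡ single =
    makerClaims rem dk≡
      (makerWins-owned _ breaker (remaining-claimBy maker rem dk≡) refl
        (singleton-owned {claimBy maker p (k , j)} single (here refl)))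

  -- The top n vertices of chain k form a reserve: either none, or everything down to the vertex
  -- just below a vertex j with {(k , j)} ∈ F.
  Threat : Fin w → ℕ → Set
  Threat k n = n ≡ 0 ⊎ Σ[ j ∈ Fin (ℓ k) ] n ≡ 2 + toℕ j × SingletonIn F (k , j)

  -- In d k ≡ s k + r k below, d k counts the unclaimed vertices of chain k and s k is its slack.
  -- The nonempty reserve at t guarantees that Breaker always has a move.
  module _ (r : Fin w → ℕ) (threat : ∀ k → Threat k (r k)) (t : Fin w) (r[t]≢0 : r t ≢ 0) where

    mutual
      makerWins-oddSlack : ∀ n {p d s} → Remaining p d → (∀ k → d k ≡ s k + r k) → sum s ≡ n → n % 2 ≡ 1 →
                           MakerWins ℓ F maker p
      makerWins-oddSlack (suc n) {s = s} rem d≡ sum≡ odd =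
        let (k , _ , sk≡) = sum≡suc⇒∃suc s sum≡
            (j , dk≡) = nextVertex rem (trans (d≡ k) (cong (_+ r k) sk≡))
        in makerClaims rem dk≡
             (makerWins-evenSlack n (remaining-claimBy maker rem dk≡) (updateAt-∸1-+ d≡ sk≡)
               (sum-updateAt-∸1 s k sk≡ sum≡) ([1+n]%2≡1⇒n%2≡0 n odd))

      makerWins-evenSlack : ∀ n {p d s} → Remaining p d → (∀ k → d k ≡ s k + r k) → sum s ≡ n → n % 2 ≡ 0 →
                            MakerWins ℓ F breaker p
      makerWins-evenSlack n rem d≡ sum≡ even =
        breakerMove (remaining-incomplete {k = t} rem (r[t]≢0 ∘ m+n≡0⇒n≡0 _ ∘ trans (sym (d≡ t))))
          λ { (k , j) legal → makerWins-afterBreaker n rem d≡ sum≡ even (remaining-legal rem legal) }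

      makerWins-afterBreaker : ∀ n {p d s k} {j : Fin (ℓ k)} → Remaining p d → (∀ k' → d k' ≡ s k' + r k') →
                               sum s ≡ n → n % 2 ≡ 0 → d k ≡ suc (toℕ j) →
                               MakerWins ℓ F maker (claimBy breaker p (k , j))
      makerWins-afterBreaker n {d = d} {s} {k} rem d≡ sum≡ even dk≡ with s k in sk≡ | threat k
      ... | suc e | _ = makerWins-afterSlackMove n rem d≡ sum≡ even dk≡ sk≡
      ... | zero  | inj₁ rk≡0 =
        ⊥-elim (0≢1+n (trans (sym (trans (d≡ k) (trans (cong (_+ r k) sk≡) rk≡0))) dk≡))
      -- Breaker entered the reserve of chain k, i.e. claimed the vertex just below j.
      ... | zero  | inj₂ (_ , rk≡ , single) =
        makerTakesSingleton (remaining-claimBy breaker rem dk≡)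
          (trans (updateAt-updates k d) (cong (_∸ 1) (trans (d≡ k) (trans (cong (_+ r k) sk≡) rk≡)))) single

      makerWins-afterSlackMove : ∀ n {p d s k e} {j : Fin (ℓ k)} → Remaining p d → (∀ k' → d k' ≡ s k' + r k') →
                                 sum s ≡ n → n % 2 ≡ 0 → d k ≡ suc (toℕ j) → s k ≡ suc e →
                                 MakerWins ℓ F maker (claimBy breaker p (k , j))
      makerWins-afterSlackMove zero {s = s} {k} rem d≡ sum≡ even dk≡ sk≡ =
        ⊥-elim (0≢1+n (trans (sym (sum≡0⇒≡0 s sum≡ k)) sk≡))
      makerWins-afterSlackMove (suc n) {s = s} {k} rem d≡ sum≡ even dk≡ sk≡ =
        makerWins-oddSlack n (remaining-claimBy breaker rem dk≡) (updateAt-∸1-+ d≡ sk≡)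
          (sum-updateAt-∸1 s k sk≡ sum≡) ([1+n]%2≡0⇒n%2≡1 n even)

  makerWins-initialSlack : (s : Fin w → ℕ) → (∀ k → s k ≤ ℓ k) → (∀ k → Threat k (ℓ k ∸ s k)) →
                           (t : Fin w) → ℓ t ∸ s t ≢ 0 → sum s % 2 ≡ 1 → MakerWins ℓ F maker (pos [] [])
  makerWins-initialSlack s s≤ℓ threat t r[t]≢0 odd =
    makerWins-oddSlack (λ k → ℓ k ∸ s k) threat t r[t]≢0 (sum s) remaining-initial
      (λ k → sym (m+[n∸m]≡n (s≤ℓ k))) refl odd

  makerWins-twoSingletons : ∀ {i i'} {ju : Fin (ℓ i)} {jv : Fin (ℓ i')} → i ≢ i' →
                            SingletonIn F (i , ju) → SingletonIn F (i' , jv) →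
                            2 + toℕ ju ≤ ℓ i → 2 + toℕ jv ≤ ℓ i' → toℕ ju % 2 ≡ 1 → toℕ jv % 2 ≡ 1 →
                            sum ℓ % 2 ≡ 1 → MakerWins ℓ F maker (pos [] [])
  makerWins-twoSingletons {i} {i'} {ju} {jv} i≢i' single-u single-v ru≤ rv≤ odd-u odd-v odd =
    makerWins-initialSlack s s≤ℓ threat i (λ r≡0 → 0≢1+n (trans (sym r≡0) reserve-i)) odd-s
    where
      ru rv : ℕ
      ru = 2 + toℕ ju
      rv = 2 + toℕ jv
      s₁ s : Fin w → ℕ
      s₁ = updateAt ℓ i (_∸ ru)
      s  = updateAt s₁ i' (_∸ rv)

      s≤ℓ : ∀ k → s k ≤ ℓ k
      s≤ℓ k = ≤-trans (updateAt-∸-≤ s₁ i' rv k) (updateAt-∸-≤ ℓ i ru k)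

      reserve-i : ℓ i ∸ s i ≡ ru
      reserve-i = trans (cong (ℓ i ∸_) (trans (updateAt-minimal i i' s₁ i≢i') (updateAt-updates i ℓ)))
                        (m∸[m∸n]≡n ru≤)

      reserve-i' : ℓ i' ∸ s i' ≡ rv
      reserve-i' = trans (cong (ℓ i' ∸_) (trans (updateAt-updates i' s₁)
                                           (cong (_∸ rv) (updateAt-minimal i' i ℓ (i≢i' ∘ sym)))))
                         (m∸[m∸n]≡n rv≤)

      reserve-other : ∀ {k} → k ≢ i → k ≢ i' → ℓ k ∸ s k ≡ 0
      reserve-other {k} k≢i k≢i' =
        trans (cong (ℓ k ∸_) (trans (updateAt-minimal k i' s₁ k≢i') (updateAt-minimal k i ℓ k≢i))) (n∸n≡0 (ℓ k))

      threat : ∀ k → Threat k (ℓ k ∸ s k)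
      threat k with k ≟ i | k ≟ i'
      ... | yes refl | _        = inj₂ (ju , reserve-i , single-u)
      ... | no _     | yes refl = inj₂ (jv , reserve-i' , single-v)
      ... | no k≢i   | no k≢i'  = inj₁ (reserve-other k≢i k≢i')

      sum-ℓ : sum ℓ ≡ ru + (rv + sum s)
      sum-ℓ = trans (sum-updateAt-∸ ℓ i ru≤)
                (cong (ru +_) (sum-updateAt-∸ s₁ i' (subst (rv ≤_) (sym (updateAt-minimal i' i ℓ (i≢i' ∘ sym))) rv≤)))

      even-reserves : (ru + rv) % 2 ≡ 0
      even-reserves = m%2≡1⇒n%2≡1⇒[m+n]%2≡0 (toℕ ju) rv odd-u odd-v

      odd-s : sum s % 2 ≡ 1
      odd-s = begin
        sum s % 2              ≡⟨ sym (m%2≡0⇒[m+n]%2≡n%2 (ru + rv) (sum s) even-reserves) ⟩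
        (ru + rv + sum s) % 2  ≡⟨ cong (_% 2) (trans (+-assoc ru rv (sum s)) (sym sum-ℓ)) ⟩
        sum ℓ % 2              ≡⟨ odd ⟩
        1                      ∎

  makerWins-oddSingletons : ∀ {i i'} (ju : Fin (ℓ i)) (jv : Fin (ℓ i')) → i ≢ i' →
                            SingletonIn F (i , ju) → SingletonIn F (i' , jv) →
                            toℕ ju % 2 ≡ 1 → toℕ jv % 2 ≡ 1 → sum ℓ % 2 ≡ 1 →
                            MakerWins ℓ F maker (pos [] [])
  makerWins-oddSingletons ju jv i≢i' single-u single-v odd-u odd-v odd
    with m≤n⇒m<n∨m≡n (toℕ<n ju) | m≤n⇒m<n∨m≡n (toℕ<n jv)
  ... | inj₂ u-bottom | _             = makerTakesSingleton remaining-initial (sym u-bottom) single-u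
  ... | inj₁ _        | inj₂ v-bottom = makerTakesSingleton remaining-initial (sym v-bottom) single-v
  ... | inj₁ ru≤      | inj₁ rv≤      = makerWins-twoSingletons i≢i' single-u single-v ru≤ rv≤ odd-u odd-v odd

black⇒odd : ∀ {w} {ℓ : Fin w → ℕ} (v : Vertex ℓ) → boardSize ℓ % 2 ≡ 1 → Black ℓ v →
            toℕ (proj₂ v) % 2 ≡ 1
black⇒odd (_ , j) odd black =
  [1+n]%2≡0⇒n%2≡1 (toℕ j) (n%2≢1⇒n%2≡0 (suc (toℕ j)) (subst (λ m → suc (toℕ j) % 2 ≢ m) odd black))

lemma4 : (w : ℕ) (ℓ : Fin w → ℕ) (F : List (List (Vertex ℓ))) →
    boardSize ℓ % 2 ≡ 1 →
    (u v : Vertex ℓ) → Black ℓ u → Black ℓ v → proj₁ u ≢ proj₁ v →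
    SingletonIn F u → SingletonIn F v →
    MakerWins ℓ F maker (pos [] [])
lemma4 w ℓ F odd u v black-u black-v chains≢ single-u single-v =
  makerWins-oddSingletons (proj₂ u) (proj₂ v) chains≢ single-u single-v
    (black⇒odd u odd black-u) (black⇒odd v odd black-v) (trans (cong (_% 2) (sym (boardSize≡sum ℓ))) odd)
  where open Game ℓ F
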